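{- Let $A$ and $B$ be disjoint finite sets with $|A|=|B|+1$, and let $s_1,s_2$ be two further vertices. Let $\mathcal{B}$ be the bipartite graph with bipartition $(A, B\cup\{s_1,s_2\})$ in which every vertex of $A$ is adjacent to every vertex of $B$, and $s_1$ and $s_2$ are each adjacent to exactly one vertex of $A$, these two vertices of $A$ being distinct. Let $P_1,P_2$ be two Hamiltonian paths of $\mathcal{B}$, both with endpoints $s_1$ and $s_2$. Then $P_1$ can be transformed into $P_2$ via a sequence of edge flips in which every intermediate spanning tree of $\mathcal{B}$ has at most three leaves.
   Context: For two spanning trees $T_1,T_2$ of a graph, $T_1$ and $T_2$ differ by an edge flip if there exist $e_1\in E(T_1)$ and $e_2\in E(T_2)$ with $E(T_2)=(E(T_1)\setminus\{e_1\})\cup\{e_2\}$; a sequence of edge flips is a sequence of spanning trees in which consecutive trees differ by an edge flip. A Hamiltonian path is viewed as a spanning tree. A leaf is a vertex of degree one. -}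

module Defs where

open import Data.Nat using (ℕ; zero; suc; _≤_)
import Data.Nat as ℕ
open import Data.Fin using (Fin)
import Data.Fin as F
open import Data.List using (List; allFin; []; _∷_; _++_; map; concatMap; length)
open import Data.Nat.ListAction using (sum)
open import Data.List.Membership.Propositional using (_∈_)
open import Data.List.Relation.Unary.Unique.Propositional using (Unique)
open import Data.Bool using (Bool; true; false; _∧_; _∨_; if_then_else_)
open import Data.Product using (Σ; Σ-syntax; _×_; _,_; proj₁; proj₂)
open import Data.Sum using (_⊎_)
open import Data.Empty using (⊥)
open import Relation.Nullary using (¬_; Dec; yes; no; does)
open import Relation.Binary.PropositionalEquality using (_≡_; _≢_; refl; cong)

data V (m : ℕ) : Set where
  a  : Fin (suc m) → V m
  b  : Fin m → V m
  s₁ : V m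
  s₂ : V m

-- Edges of 𝓑 : every a i – b j, plus one edge at s₁ and one edge at s₂.
data E (m : ℕ) : Set where
  ab : Fin (suc m) → Fin m → E m
  t₁ : E m
  t₂ : E m

_≟V_ : ∀ {m} → (u v : V m) → Dec (u ≡ v)
a i ≟V a j with i F.≟ j
... | yes refl = yes refl
... | no ne = no λ { refl → ne refl }
a _ ≟V b _ = no λ ()
a _ ≟V s₁ = no λ ()
a _ ≟V s₂ = no λ ()
b _ ≟V a _ = no λ ()
b i ≟V b j with i F.≟ j
... | yes refl = yes refl
... | no ne = no λ { refl → ne refl }
b _ ≟V s₁ = no λ ()
b _ ≟V s₂ = no λ ()
s₁ ≟V a _ = no λ ()
s₁ ≟V b _ = no λ ()
s₁ ≟V s₁ = yes refl
s₁ ≟V s₂ = no λ ()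
s₂ ≟V a _ = no λ ()
s₂ ≟V b _ = no λ ()
s₂ ≟V s₁ = no λ ()
s₂ ≟V s₂ = yes refl

allV : (m : ℕ) → List (V m)
allV m = map a (allFin (suc m)) ++ map b (allFin m) ++ s₁ ∷ s₂ ∷ []

allE : (m : ℕ) → List (E m)
allE m = concatMap (λ i → map (ab i) (allFin m)) (allFin (suc m)) ++ t₁ ∷ t₂ ∷ []

-- Edge subsets of 𝓑 (spanning subgraphs, vertex set = all of V m).
Sub : ℕ → Set
Sub m = E m → Bool

-- The graph 𝓑, determined by the neighbours a a₁ of s₁ and a a₂ of s₂.
module 𝓑 {m : ℕ} (a₁ a₂ : Fin (suc m)) where

  ends : E m → V m × V m
  ends (ab i j) = a i , b j
  ends t₁ = s₁ , a a₁
  ends t₂ = s₂ , a a₂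

  Joins : E m → V m → V m → Set
  Joins e u w = ends e ≡ (u , w) ⊎ ends e ≡ (w , u)

  data Walk (T : Sub m) : V m → V m → Set where
    []  : ∀ {u} → Walk T u u
    step : ∀ {u w v} (e : E m) → T e ≡ true → Joins e u w → Walk T w v → Walk T u v

  wlen : ∀ {T u v} → Walk T u v → ℕ
  wlen [] = zero
  wlen (step _ _ _ w) = suc (wlen w)

  vertsAll : ∀ {T u v} → Walk T u v → List (V m)
  vertsAll {u = u} [] = u ∷ []
  vertsAll {u = u} (step _ _ _ w) = u ∷ vertsAll w

  vertsInit : ∀ {T u v} → Walk T u v → List (V m)
  vertsInit [] = []
  vertsInit {u = u} (step _ _ _ w) = u ∷ vertsInit w

  edgesOf : ∀ {T u v} → Walk T u v → List (E m)
  edgesOf [] = []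
  edgesOf (step e _ _ w) = e ∷ edgesOf w

  Cycle : Sub m → Set
  Cycle T = Σ[ u ∈ V m ] Σ[ w ∈ Walk T u u ] (3 ≤ wlen w × Unique (vertsInit w))

  Connected : Sub m → Set
  Connected T = (u v : V m) → Walk T u v

  IsSpanningTree : Sub m → Set
  IsSpanningTree T = Connected T × ¬ Cycle T

  -- Hamiltonian path from x to y, viewed as the spanning tree whose edges
  -- are exactly the edges of the path.
  IsHamPath : Sub m → V m → V m → Set
  IsHamPath T x y = Σ[ w ∈ Walk T x y ]
    (Unique (vertsAll w) × ((v : V m) → v ∈ vertsAll w) × ((e : E m) → T e ≡ true → e ∈ edgesOf w))

  incident : E m → V m → Bool
  incident e v = does (v ≟V proj₁ (ends e)) ∨ does (v ≟V proj₂ (ends e))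

  degree : Sub m → V m → ℕ
  degree T v = sum (map (λ e → if T e ∧ incident e v then 1 else 0) (allE m))

  numLeaves : Sub m → ℕ
  numLeaves T = sum (map (λ v → if does (degree T v ℕ.≟ 1) then 1 else 0) (allV m))

  EdgeFlip : Sub m → Sub m → Set
  EdgeFlip T₁ T₂ = Σ[ e₁ ∈ E m ] Σ[ e₂ ∈ E m ]
    (T₁ e₁ ≡ true × T₂ e₂ ≡ true ×
     ((e : E m) → (T₂ e ≡ true → (T₁ e ≡ true × e ≢ e₁) ⊎ e ≡ e₂)
                × ((T₁ e ≡ true × e ≢ e₁) ⊎ e ≡ e₂ → T₂ e ≡ true)))

  data FlipSeq≤3 : Sub m → Sub m → Set where
    done : ∀ {T T'} → ((e : E m) → T e ≡ T' e) → FlipSeq≤3 T T'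
    flip : ∀ {T T' T''} → EdgeFlip T T' → IsSpanningTree T' → numLeaves T' ≤ 3 →
           FlipSeq≤3 T' T'' → FlipSeq≤3 T T''

module Submission where

-- A Hamiltonian s₁–s₂ path of 𝓑 is recorded as an ordering
-- of the vertices: a bijection V m ≅ {0, …, n} placing s₁, a a₁, a a₂, s₂ at
-- 0, 1, n-1, n and the A-vertices exactly at the odd positions; a subgraph is
-- then described by the relation on positions that its edges realise.  The
-- basic swap move exchanges the vertices at positions i+1 and i+3 (1 ≤ i,
-- i+5 ≤ n) by two edge flips: remove {i, i+1}, add {i, i+3}; then remove
-- {i+3, i+4}, add {i+1, i+4}.  The tree in between is a "broken path" (the
-- path with {c, c+1} replaced by {d, c+1}), a spanning tree whose only leaves
-- are s₁, s₂ and the vertex at position c.  Since both orderings have the same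
-- parity pattern, the vertex wanted at position k sits an even distance later
-- and swap moves bring it forward; this bubble sort turns P₁ into P₂.

open import Defs
open import Data.Nat using (ℕ; zero; suc; pred; _+_; _∸_; _≤_; _<_; z≤n; s≤s; >-nonZero)
import Data.Nat as ℕ
open import Data.Nat.Properties
open import Algebra.Properties.CommutativeSemigroup +-commutativeSemigroup using (interchange)
open import Data.Nat.ListAction using (sum)
open import Data.Fin using (Fin; toℕ; fromℕ<)
import Data.Fin as F
import Data.Fin.Properties as FP
open import Data.List using (List; []; _∷_; _++_; map; allFin; concatMap)
open import Data.List.Membership.Propositional using (_∈_; _∉_)
open import Data.List.Membership.Propositional.Properties
  using (∈-++⁺ˡ; ∈-++⁺ʳ; ∈-++⁻; ∈-map⁺; ∈-map⁻; ∈-allFin; ∈-concatMap⁺)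
open import Data.List.Membership.Setoid.Properties using (unique⇒irrelevant)
open import Data.List.Relation.Unary.Any using (here; there)
import Data.List.Relation.Unary.Any as Any
open import Data.List.Relation.Unary.All using ([]; _∷_)
import Data.List.Relation.Unary.All as All
open import Data.List.Relation.Unary.Unique.Propositional using (Unique; []; _∷_)
open import Data.List.Relation.Unary.Unique.Propositional.Properties using (allFin⁺; map⁺; ++⁺)
open import Axiom.UniquenessOfIdentityProofs using (module Decidable⇒UIP)
open import Data.Bool using (Bool; true; false; _∧_; _∨_; not; if_then_else_)
open import Data.Bool.Properties using (not-involutive; not-¬; ∨-zeroʳ; ⇔→≡)
open import Data.Product using (Σ; _×_; _,_; proj₁; proj₂)
open import Data.Sum using (_⊎_; inj₁; inj₂)
open import Data.Empty using (⊥; ⊥-elim)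
open import Function using (_∘_)
open import Function.Bundles using (mk⇔)
open import Relation.Nullary using (¬_; Dec; yes; no; does)
open import Relation.Nullary.Decidable using (_×-dec_; _⊎-dec_)
open import Relation.Binary.PropositionalEquality

Pair : ℕ → ℕ → ℕ → ℕ → Set
Pair P Q x y = (P ≡ x × Q ≡ y) ⊎ (P ≡ y × Q ≡ x)

pair-sym : ∀ {P Q x y} → Pair P Q x y → Pair Q P x y
pair-sym (inj₁ (p , q)) = inj₂ (q , p)
pair-sym (inj₂ (p , q)) = inj₁ (q , p)

pair? : ∀ P Q x y → Dec (Pair P Q x y)
pair? P Q x y = ((P ℕ.≟ x) ×-dec (Q ℕ.≟ y)) ⊎-dec ((P ℕ.≟ y) ×-dec (Q ℕ.≟ x))

Consecutive : ℕ → ℕ → Set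
Consecutive P Q = suc P ≡ Q ⊎ suc Q ≡ P

consecutive-sym : ∀ {P Q} → Consecutive P Q → Consecutive Q P
consecutive-sym (inj₁ e) = inj₂ e
consecutive-sym (inj₂ e) = inj₁ e

pair⇒consecutive : ∀ {P Q x} → Pair P Q x (suc x) → Consecutive P Q
pair⇒consecutive (inj₁ (refl , refl)) = inj₁ refl
pair⇒consecutive (inj₂ (refl , refl)) = inj₂ refl

pathEdge-injective : ∀ {k c} → k ≢ c → ¬ Pair k (suc k) c (suc c)
pathEdge-injective k≢c (inj₁ (k≡c , _)) = k≢c k≡c
pathEdge-injective {k} {c} _ (inj₂ (k≡1+c , 1+k≡c)) =
  m≢1+n+m c {1} (sym (trans (cong suc (sym k≡1+c)) 1+k≡c))

-- The path with its edge {c, c+1} replaced by {d, c+1} (where d ≤ c): the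
-- vertices after position c hang off position d instead of position c.
BrokenPath : ℕ → ℕ → ℕ → ℕ → Set
BrokenPath c d P Q = (Consecutive P Q × ¬ Pair P Q c (suc c)) ⊎ Pair P Q d (suc c)

brokenPath-sym : ∀ {c d P Q} → BrokenPath c d P Q → BrokenPath c d Q P
brokenPath-sym (inj₁ (cons , np)) = inj₁ (consecutive-sym cons , np ∘ pair-sym)
brokenPath-sym (inj₂ pr) = inj₂ (pair-sym pr)

-- For d = c nothing is broken: the path itself.
consecutive⇒unbroken : ∀ {c P Q} → Consecutive P Q → BrokenPath c c P Q
consecutive⇒unbroken {c} {P} {Q} cons with pair? P Q c (suc c)
... | yes pr = inj₂ pr
... | no npr = inj₁ (cons , npr)

unbroken⇒consecutive : ∀ {c P Q} → BrokenPath c c P Q → Consecutive P Q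
unbroken⇒consecutive (inj₁ (cons , _)) = cons
unbroken⇒consecutive (inj₂ pr) = pair⇒consecutive pr

-- Parity of positions: A-vertices sit exactly at the odd positions.
odd : ℕ → Bool
odd zero = false
odd (suc k) = not (odd k)

odd-2+ : ∀ k → odd (2 + k) ≡ odd k
odd-2+ k = not-involutive (odd k)

twice : ℕ → ℕ
twice zero = zero
twice (suc d) = suc (suc (twice d))

sameParity⇒even : ∀ x k → odd k ≡ odd (x + k) → Σ ℕ λ d → x ≡ twice d
sameParity⇒even zero k _ = 0 , refl
sameParity⇒even (suc zero) k eq = ⊥-elim (not-¬ refl eq)
sameParity⇒even (suc (suc x)) k eq with sameParity⇒even x k (trans eq (odd-2+ (x + k)))
... | d , refl = suc d , refl

-- The transposition σ of the positions c₁ = i+1 and c₂ = i+3, and how the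
-- trees of one swap move look after renumbering positions by σ.
module Transposition (i : ℕ) where
  c₁ c₂ : ℕ
  c₁ = 1 + i
  c₂ = 3 + i

  σ : ℕ → ℕ
  σ k with k ℕ.≟ c₁ | k ℕ.≟ c₂
  ... | yes _ | _ = c₂
  ... | no _ | yes _ = c₁
  ... | no _ | no _ = k

  σ-c₁ : σ c₁ ≡ c₂
  σ-c₁ with c₁ ℕ.≟ c₁
  ... | yes _ = refl
  ... | no c₁≢c₁ = ⊥-elim (c₁≢c₁ refl)

  σ-c₂ : σ c₂ ≡ c₁
  σ-c₂ with c₂ ℕ.≟ c₁ | c₂ ℕ.≟ c₂
  ... | yes c₂≡c₁ | _ = ⊥-elim (m≢1+n+m c₁ {1} (sym c₂≡c₁))
  ... | no _ | yes _ = refl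
  ... | no _ | no c₂≢c₂ = ⊥-elim (c₂≢c₂ refl)

  σ-fixed : ∀ k → k ≢ c₁ → k ≢ c₂ → σ k ≡ k
  σ-fixed k k≢c₁ k≢c₂ with k ℕ.≟ c₁ | k ℕ.≟ c₂
  ... | yes k≡c₁ | _ = ⊥-elim (k≢c₁ k≡c₁)
  ... | no _ | yes k≡c₂ = ⊥-elim (k≢c₂ k≡c₂)
  ... | no _ | no _ = refl

  σ-involutive : ∀ k → σ (σ k) ≡ k
  σ-involutive k with k ℕ.≟ c₁ | k ℕ.≟ c₂
  ... | yes refl | _ = σ-c₂
  ... | no _ | yes refl = σ-c₁
  ... | no k≢c₁ | no k≢c₂ = σ-fixed k k≢c₁ k≢c₂

  σ-transpose : ∀ {P x} → σ P ≡ x → P ≡ σ x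
  σ-transpose {P} eq = trans (sym (σ-involutive P)) (cong σ eq)

  σ-i : σ i ≡ i
  σ-i = σ-fixed i (m≢1+n+m i {0}) (m≢1+n+m i {2})

  σ-2+i : σ (2 + i) ≡ 2 + i
  σ-2+i = σ-fixed (2 + i) (λ e → m≢1+n+m c₁ {0} (sym e)) (m≢1+n+m (2 + i) {0})

  σ-4+i : σ (4 + i) ≡ 4 + i
  σ-4+i = σ-fixed (4 + i) (λ e → m≢1+n+m c₁ {2} (sym e)) (λ e → m≢1+n+m c₂ {0} (sym e))

  σ-parity : ∀ k → odd (σ k) ≡ odd k
  σ-parity k with k ℕ.≟ c₁ | k ℕ.≟ c₂
  ... | yes refl | _ = odd-2+ c₁
  ... | no _ | yes refl = sym (odd-2+ c₁)
  ... | no _ | no _ = refl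

  σ-bounded : ∀ {n} k → k ≤ n → c₂ ≤ n → σ k ≤ n
  σ-bounded k k≤n c₂≤n with k ℕ.≟ c₁ | k ℕ.≟ c₂
  ... | yes _ | _ = c₂≤n
  ... | no _ | yes _ = ≤-trans (n≤1+n c₁) (≤-trans (n≤1+n (suc c₁)) c₂≤n)
  ... | no _ | no _ = k≤n

  data Window (P : ℕ) : Set where
    at-i : P ≡ i → Window P
    at-c₁ : P ≡ c₁ → Window P
    at-2+i : P ≡ 2 + i → Window P
    at-c₂ : P ≡ c₂ → Window P
    outside : P ≢ i → P ≢ c₁ → P ≢ 2 + i → P ≢ c₂ → Window P

  window : ∀ P → Window P
  window P with P ℕ.≟ i | P ℕ.≟ c₁ | P ℕ.≟ 2 + i | P ℕ.≟ c₂
  ... | yes e | _ | _ | _ = at-i e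
  ... | no _ | yes e | _ | _ = at-c₁ e
  ... | no _ | no _ | yes e | _ = at-2+i e
  ... | no _ | no _ | no _ | yes e = at-c₂ e
  ... | no n₀ | no n₁ | no n₂ | no n₃ = outside n₀ n₁ n₂ n₃

  -- First flip of the swap move, in the new numbering: the old path (consecutive
  -- in the numbering σ) without its edge {i, i+1}, i.e. the new {i, c₂}, and with
  -- the new edge {i, c₁}.
  FirstFlip : ℕ → ℕ → Set
  FirstFlip P Q = (Consecutive (σ P) (σ Q) × ¬ Pair P Q i c₂) ⊎ Pair P Q i c₁

  oldStep⇒broken : ∀ P Q → suc (σ P) ≡ σ Q → ¬ Pair P Q i c₂ → BrokenPath c₂ c₁ P Q
  oldStep⇒broken P Q eq np with window (σ P)
  ... | at-i e = ⊥-elim (np (inj₁ (trans (σ-transpose e) σ-i ,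
                                   trans (σ-transpose (trans (sym eq) (cong suc e))) σ-c₁)))
  ... | at-c₁ e =
    let p = trans (σ-transpose e) σ-c₁
        q = trans (σ-transpose (trans (sym eq) (cong suc e))) σ-2+i
    in inj₁ (inj₂ (trans (cong suc q) (sym p)) ,
             λ { (inj₁ (_ , Q≡)) → m≢1+n+m (2 + i) {1} (trans (sym q) Q≡)
               ; (inj₂ (P≡ , _)) → m≢1+n+m (3 + i) {0} (trans (sym p) P≡) })
  ... | at-2+i e =
    let p = trans (σ-transpose e) σ-2+i
        q = trans (σ-transpose (trans (sym eq) (cong suc e))) σ-c₂
    in inj₁ (inj₂ (trans (cong suc q) (sym p)) ,
             λ { (inj₁ (P≡ , _)) → m≢1+n+m (2 + i) {0} (trans (sym p) P≡)
               ; (inj₂ (P≡ , _)) → m≢1+n+m (2 + i) {1} (trans (sym p) P≡) })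
  ... | at-c₂ e = inj₂ (inj₁ (trans (σ-transpose e) σ-c₂ ,
                              trans (σ-transpose (trans (sym eq) (cong suc e))) σ-4+i))
  ... | outside n₀ n₁ n₂ n₃ =
    let q : Q ≡ suc (σ P)
        q = trans (σ-transpose (sym eq))
                  (σ-fixed (suc (σ P)) (n₀ ∘ suc-injective) (n₂ ∘ suc-injective))
        p : P ≡ σ P
        p = trans (σ-transpose refl) (σ-fixed (σ P) n₁ n₃)
    in inj₁ (inj₁ (trans (cong suc p) (sym q)) ,
             λ { (inj₁ (P≡ , _)) → n₃ (trans (sym p) P≡)
               ; (inj₂ (P≡ , Q≡)) → m≢1+n+m c₂ {1}
                                      (trans (sym Q≡) (trans q (cong suc (trans (sym p) P≡)))) })

  firstFlip⇒broken : ∀ P Q → FirstFlip P Q → BrokenPath c₂ c₁ P Q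
  firstFlip⇒broken P Q (inj₁ (inj₁ eq , np)) = oldStep⇒broken P Q eq np
  firstFlip⇒broken P Q (inj₁ (inj₂ eq , np)) = brokenPath-sym (oldStep⇒broken Q P eq (np ∘ pair-sym))
  firstFlip⇒broken P Q (inj₂ pr) = inj₁ (pair⇒consecutive pr , disjoint pr)
    where
    disjoint : Pair P Q i c₁ → ¬ Pair P Q c₂ (suc c₂)
    disjoint (inj₁ (p , _)) (inj₁ (p' , _)) = m≢1+n+m i {2} (trans (sym p) p')
    disjoint (inj₁ (p , _)) (inj₂ (p' , _)) = m≢1+n+m i {3} (trans (sym p) p')
    disjoint (inj₂ (p , _)) (inj₁ (p' , _)) = m≢1+n+m c₁ {1} (trans (sym p) p')
    disjoint (inj₂ (p , _)) (inj₂ (p' , _)) = m≢1+n+m c₁ {2} (trans (sym p) p')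

  newStep⇒firstFlip : ∀ P Q → suc P ≡ Q → ¬ Pair P Q c₂ (suc c₂) → FirstFlip P Q
  newStep⇒firstFlip P Q sp np with window P
  ... | at-i e = inj₂ (inj₁ (e , trans (sym sp) (cong suc e)))
  ... | at-c₁ e =
    let q = trans (sym sp) (cong suc e) in
    inj₁ (inj₂ (trans (cong (suc ∘ σ) q) (trans (cong suc σ-2+i) (trans (sym σ-c₁) (cong σ (sym e))))) ,
          λ { (inj₁ (P≡ , _)) → m≢1+n+m i {0} (sym (trans (sym e) P≡))
            ; (inj₂ (P≡ , _)) → m≢1+n+m c₁ {1} (trans (sym e) P≡) })
  ... | at-2+i e =
    let q = trans (sym sp) (cong suc e) in
    inj₁ (inj₂ (trans (cong (suc ∘ σ) q) (trans (cong suc σ-c₂) (trans (sym σ-2+i) (cong σ (sym e))))) ,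
          λ { (inj₁ (P≡ , _)) → m≢1+n+m i {1} (sym (trans (sym e) P≡))
            ; (inj₂ (P≡ , _)) → m≢1+n+m (2 + i) {0} (trans (sym e) P≡) })
  ... | at-c₂ e = ⊥-elim (np (inj₁ (e , trans (sym sp) (cong suc e))))
  ... | outside n₀ n₁ n₂ n₃ =
    let σP = σ-fixed P n₁ n₃
        σQ = σ-fixed Q (λ e → n₀ (suc-injective (trans sp e))) (λ e → n₂ (suc-injective (trans sp e)))
    in inj₁ (inj₁ (trans (cong suc σP) (trans sp (sym σQ))) ,
             λ { (inj₁ (P≡ , _)) → n₀ P≡ ; (inj₂ (P≡ , _)) → n₃ P≡ })

  broken⇒firstFlip : ∀ P Q → BrokenPath c₂ c₁ P Q → FirstFlip P Q
  broken⇒firstFlip P Q (inj₁ (inj₁ sp , np)) = newStep⇒firstFlip P Q sp np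
  broken⇒firstFlip P Q (inj₁ (inj₂ sq , np)) = firstFlip-sym (newStep⇒firstFlip Q P sq (np ∘ pair-sym))
    where
    firstFlip-sym : FirstFlip Q P → FirstFlip P Q
    firstFlip-sym (inj₁ (cons , np')) = inj₁ (consecutive-sym cons , np' ∘ pair-sym)
    firstFlip-sym (inj₂ pr) = inj₂ (pair-sym pr)
  broken⇒firstFlip P Q (inj₂ (inj₁ (p , q))) =
    inj₁ (inj₁ (trans (cong (suc ∘ σ) p) (trans (cong suc σ-c₁) (trans (sym σ-4+i) (cong σ (sym q))))) ,
          λ { (inj₁ (P≡ , _)) → m≢1+n+m i {0} (sym (trans (sym p) P≡))
            ; (inj₂ (P≡ , _)) → m≢1+n+m c₁ {1} (trans (sym p) P≡) })
  broken⇒firstFlip P Q (inj₂ (inj₂ (p , q))) =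
    inj₁ (inj₂ (trans (cong (suc ∘ σ) q) (trans (cong suc σ-c₁) (trans (sym σ-4+i) (cong σ (sym p))))) ,
          λ { (inj₁ (_ , Q≡)) → m≢1+n+m c₁ {1} (trans (sym q) Q≡)
            ; (inj₂ (_ , Q≡)) → m≢1+n+m i {0} (sym (trans (sym q) Q≡)) })

  -- Second flip of the swap move: remove {c₁, i+4}, add {c₂, i+4}; the result
  -- is the path of the new numbering.
  SecondFlip : ℕ → ℕ → Set
  SecondFlip P Q = (BrokenPath c₂ c₁ P Q × ¬ Pair P Q c₁ (suc c₂)) ⊎ Pair P Q c₂ (suc c₂)

  secondFlip⇒consecutive : ∀ {P Q} → SecondFlip P Q → Consecutive P Q
  secondFlip⇒consecutive (inj₁ (inj₁ (cons , _) , _)) = cons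
  secondFlip⇒consecutive (inj₁ (inj₂ pr , npr)) = ⊥-elim (npr pr)
  secondFlip⇒consecutive (inj₂ pr) = pair⇒consecutive pr

  consecutive⇒secondFlip : ∀ {P Q} → Consecutive P Q → SecondFlip P Q
  consecutive⇒secondFlip {P} {Q} cons with pair? P Q c₂ (suc c₂)
  ... | yes pr = inj₂ pr
  ... | no npr = inj₁ (inj₁ (cons , npr) , farApart cons)
    where
    farApart : ∀ {P Q} → Consecutive P Q → ¬ Pair P Q c₁ (suc c₂)
    farApart (inj₁ e) (inj₁ (refl , refl)) = m≢1+n+m (2 + i) {1} e
    farApart (inj₂ e) (inj₁ (refl , refl)) = m≢1+n+m c₁ {3} (sym e)
    farApart (inj₁ e) (inj₂ (refl , refl)) = m≢1+n+m c₁ {3} (sym e)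
    farApart (inj₂ e) (inj₂ (refl , refl)) = m≢1+n+m (2 + i) {1} e

sum-map-mono : ∀ {A : Set} {f g : A → ℕ} → (∀ x → f x ≤ g x) → ∀ L → sum (map f L) ≤ sum (map g L)
sum-map-mono f≤g [] = z≤n
sum-map-mono f≤g (x ∷ L) = +-mono-≤ (f≤g x) (sum-map-mono f≤g L)

sum-map-+ : ∀ {A : Set} (f g : A → ℕ) L → sum (map (λ x → f x + g x) L) ≡ sum (map f L) + sum (map g L)
sum-map-+ f g [] = refl
sum-map-+ f g (x ∷ L) = trans (cong (f x + g x +_) (sum-map-+ f g L)) (interchange (f x) (g x) _ _)

indexOf : ∀ {A : Set} {v : A} {L : List A} → v ∈ L → ℕ
indexOf (here _) = 0
indexOf (there p) = suc (indexOf p)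

one≤sum : ∀ {A : Set} (h : A → ℕ) {x} {L : List A} → x ∈ L → h x ≡ 1 → 1 ≤ sum (map h L)
one≤sum h (here refl) hx = ≤-trans (≤-reflexive (sym hx)) (m≤m+n _ _)
one≤sum h {L = y ∷ L} (there p) hx = ≤-trans (one≤sum h p hx) (m≤n+m _ (h y))

two≤sum : ∀ {A : Set} (h : A → ℕ) {x x'} {L : List A} → x ∈ L → x' ∈ L → x ≢ x' →
          h x ≡ 1 → h x' ≡ 1 → 2 ≤ sum (map h L)
two≤sum h (here refl) (here refl) x≢x' _ _ = ⊥-elim (x≢x' refl)
two≤sum h (here refl) (there q) _ hx hx' rewrite hx = s≤s (one≤sum h q hx')
two≤sum h (there p) (here refl) _ hx hx' rewrite hx' = s≤s (one≤sum h p hx)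
two≤sum h {L = y ∷ L} (there p) (there q) x≢x' hx hx' =
  ≤-trans (two≤sum h p q x≢x' hx hx') (m≤n+m _ (h y))

module Graph {m : ℕ} (a₁ a₂ : Fin (suc m)) where
  open 𝓑 a₁ a₂

  a-injective : ∀ {i j : Fin (suc m)} → a {m} i ≡ a j → i ≡ j
  a-injective refl = refl

  b-injective : ∀ {i j : Fin m} → b {m} i ≡ b j → i ≡ j
  b-injective refl = refl

  _≟E_ : (e e' : E m) → Dec (e ≡ e')
  ab i j ≟E ab i' j' with i F.≟ i' | j F.≟ j'
  ... | yes refl | yes refl = yes refl
  ... | no i≢i' | _ = no λ { refl → i≢i' refl }
  ... | yes _ | no j≢j' = no λ { refl → j≢j' refl }
  ab _ _ ≟E t₁ = no λ ()
  ab _ _ ≟E t₂ = no λ ()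
  t₁ ≟E ab _ _ = no λ ()
  t₁ ≟E t₁ = yes refl
  t₁ ≟E t₂ = no λ ()
  t₂ ≟E ab _ _ = no λ ()
  t₂ ≟E t₁ = no λ ()
  t₂ ≟E t₂ = yes refl

  -- An edge is determined by its end pair, and no edge has the reversed end
  -- pair of another one (every edge is listed as A–B, s₁–A or s₂–A).
  ends-injective : ∀ {e e'} → ends e ≡ ends e' → e ≡ e'
  ends-injective {ab i j} {ab .i .j} refl = refl
  ends-injective {t₁} {t₁} refl = refl
  ends-injective {t₂} {t₂} refl = refl

  ends-notReversed : ∀ {e e' u w} → ends e ≡ (u , w) → ends e' ≡ (w , u) → ⊥
  ends-notReversed {ab _ _} {ab _ _} refl ()
  ends-notReversed {ab _ _} {t₁} refl ()
  ends-notReversed {ab _ _} {t₂} refl ()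
  ends-notReversed {t₁} {ab _ _} refl ()
  ends-notReversed {t₁} {t₁} refl ()
  ends-notReversed {t₁} {t₂} refl ()
  ends-notReversed {t₂} {ab _ _} refl ()
  ends-notReversed {t₂} {t₁} refl ()
  ends-notReversed {t₂} {t₂} refl ()

  joins-sym : ∀ {e u w} → Joins e u w → Joins e w u
  joins-sym (inj₁ p) = inj₂ p
  joins-sym (inj₂ p) = inj₁ p

  joins-unique : ∀ {e e' u w} → Joins e u w → Joins e' u w → e ≡ e'
  joins-unique (inj₁ p) (inj₁ q) = ends-injective (trans p (sym q))
  joins-unique (inj₁ p) (inj₂ q) = ⊥-elim (ends-notReversed p q)
  joins-unique (inj₂ p) (inj₁ q) = ⊥-elim (ends-notReversed q p)
  joins-unique (inj₂ p) (inj₂ q) = ends-injective (trans p (sym q))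

  joins-otherEnd : ∀ {e u w w'} → Joins e u w → Joins e u w' → w ≡ w'
  joins-otherEnd (inj₁ p) (inj₁ q) = cong proj₂ (trans (sym p) q)
  joins-otherEnd (inj₁ p) (inj₂ q) = let r = trans (sym p) q in trans (cong proj₂ r) (cong proj₁ r)
  joins-otherEnd (inj₂ p) (inj₁ q) = let r = trans (sym p) q in trans (cong proj₁ r) (cong proj₂ r)
  joins-otherEnd (inj₂ p) (inj₂ q) = cong proj₁ (trans (sym p) q)

  isA : V m → Bool
  isA (a _) = true
  isA (b _) = false
  isA s₁ = false
  isA s₂ = false

  isA-joins : ∀ {e u v} → Joins e u v → isA v ≡ not (isA u)
  isA-joins {ab _ _} (inj₁ refl) = refl
  isA-joins {ab _ _} (inj₂ refl) = refl
  isA-joins {t₁} (inj₁ refl) = refl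
  isA-joins {t₁} (inj₂ refl) = refl
  isA-joins {t₂} (inj₁ refl) = refl
  isA-joins {t₂} (inj₂ refl) = refl

  s₁-neighbour : ∀ {e v} → Joins e s₁ v → v ≡ a a₁
  s₁-neighbour {ab _ _} (inj₁ ())
  s₁-neighbour {ab _ _} (inj₂ ())
  s₁-neighbour {t₁} (inj₁ refl) = refl
  s₁-neighbour {t₁} (inj₂ ())
  s₁-neighbour {t₂} (inj₁ ())
  s₁-neighbour {t₂} (inj₂ ())

  s₂-neighbour : ∀ {e v} → Joins e v s₂ → v ≡ a a₂
  s₂-neighbour {ab _ _} (inj₁ ())
  s₂-neighbour {ab _ _} (inj₂ ())
  s₂-neighbour {t₁} (inj₁ ())
  s₂-neighbour {t₁} (inj₂ ())
  s₂-neighbour {t₂} (inj₁ ())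
  s₂-neighbour {t₂} (inj₂ refl) = refl

  crossEdge : ∀ (u w : V m) → isA u ≡ not (isA w) → u ≢ s₁ → u ≢ s₂ → w ≢ s₁ → w ≢ s₂ →
              Σ (E m) λ e → Joins e u w
  crossEdge (a i) (b j) _ _ _ _ _ = ab i j , inj₁ refl
  crossEdge (b j) (a i) _ _ _ _ _ = ab i j , inj₂ refl
  crossEdge (a _) (a _) () _ _ _ _
  crossEdge (b _) (b _) () _ _ _ _
  crossEdge _ s₁ _ _ _ w≢s₁ _ = ⊥-elim (w≢s₁ refl)
  crossEdge _ s₂ _ _ _ _ w≢s₂ = ⊥-elim (w≢s₂ refl)
  crossEdge s₁ _ _ u≢s₁ _ _ _ = ⊥-elim (u≢s₁ refl)
  crossEdge s₂ _ _ _ u≢s₂ _ _ = ⊥-elim (u≢s₂ refl)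

  _++ʷ_ : ∀ {T x y z} → Walk T x y → Walk T y z → Walk T x z
  [] ++ʷ w' = w'
  step e p j w ++ʷ w' = step e p j (w ++ʷ w')

  reverseʷ : ∀ {T x y} → Walk T x y → Walk T y x
  reverseʷ [] = []
  reverseʷ (step e p j w) = reverseʷ w ++ʷ step e p (joins-sym j) []

  start∈ : ∀ {T x y} (w : Walk T x y) → x ∈ vertsAll w
  start∈ [] = here refl
  start∈ (step _ _ _ _) = here refl

  end∈ : ∀ {T x y} (w : Walk T x y) → y ∈ vertsAll w
  end∈ [] = here refl
  end∈ (step _ _ _ w) = there (end∈ w)

  vertsAll-split : ∀ {T x y z} (w : Walk T x y) → z ∈ vertsAll w → z ∈ vertsInit w ⊎ z ≡ y
  vertsAll-split [] (here refl) = inj₂ refl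
  vertsAll-split (step _ _ _ w) (here refl) = inj₁ (here refl)
  vertsAll-split (step _ _ _ w) (there q) with vertsAll-split w q
  ... | inj₁ r = inj₁ (there r)
  ... | inj₂ r = inj₂ r

  Simple : ∀ {T x y} → Walk T x y → Set
  Simple w = Unique (vertsAll w)

  simple-fromInit : ∀ {T x y} (w : Walk T x y) → Unique (y ∷ vertsInit w) → Simple w
  simple-fromInit [] _ = [] ∷ []
  simple-fromInit (step e p j w) ((y∉ ∷ x∉) ∷ (x∉' ∷ u)) =
    All.tabulate (λ z∈ → avoidsStart z∈) ∷ simple-fromInit w (x∉ ∷ u)
    where
    avoidsStart : ∀ {z} → z ∈ vertsAll w → _ ≢ z
    avoidsStart z∈ refl with vertsAll-split w z∈
    ... | inj₁ r = All.lookup x∉' r refl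
    ... | inj₂ refl = y∉ refl

  closed-notSimple : ∀ {T u} (w : Walk T u u) → 1 ≤ wlen w → ¬ Simple w
  closed-notSimple (step _ _ _ w) _ (u∉ ∷ _) = All.lookup u∉ (end∈ w) refl

  vertexAt : ∀ {T x y} → Walk T x y → ℕ → V m
  vertexAt {x = x} w zero = x
  vertexAt {y = y} [] (suc k) = y
  vertexAt (step _ _ _ w) (suc k) = vertexAt w k

  vertexAt-end : ∀ {T x y} (w : Walk T x y) → vertexAt w (wlen w) ≡ y
  vertexAt-end [] = refl
  vertexAt-end (step _ _ _ w) = vertexAt-end w

  vertexAt-index : ∀ {T x y} (w : Walk T x y) {v} (p : v ∈ vertsAll w) → vertexAt w (indexOf p) ≡ v
  vertexAt-index [] (here refl) = refl
  vertexAt-index (step _ _ _ w) (here refl) = refl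
  vertexAt-index (step _ _ _ w) (there p) = vertexAt-index w p

  index≤wlen : ∀ {T x y} (w : Walk T x y) {v} (p : v ∈ vertsAll w) → indexOf p ≤ wlen w
  index≤wlen [] (here refl) = z≤n
  index≤wlen (step _ _ _ w) (here refl) = z≤n
  index≤wlen (step _ _ _ w) (there p) = s≤s (index≤wlen w p)

  vertexAt-member : ∀ {T x y} (w : Walk T x y) k → k ≤ wlen w → Σ (vertexAt w k ∈ vertsAll w) λ q → indexOf q ≡ k
  vertexAt-member [] zero _ = here refl , refl
  vertexAt-member (step _ _ _ w) zero _ = here refl , refl
  vertexAt-member (step _ _ _ w) (suc k) (s≤s k≤) =
    let q , eq = vertexAt-member w k k≤ in there q , cong suc eq

  stepEdge : ∀ {T x y} (w : Walk T x y) k → suc k ≤ wlen w →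
             Σ (E m) λ e → T e ≡ true × Joins e (vertexAt w k) (vertexAt w (suc k))
  stepEdge (step e p j w) zero _ = e , p , j
  stepEdge (step e p j w) (suc k) (s≤s k<) = stepEdge w k k<

  edgeIndex : ∀ {T x y} (w : Walk T x y) {e} → e ∈ edgesOf w →
              Σ ℕ λ k → suc k ≤ wlen w × Joins e (vertexAt w k) (vertexAt w (suc k))
  edgeIndex (step e p j w) (here refl) = 0 , s≤s z≤n , j
  edgeIndex (step e p j w) (there q) =
    let k , k< , j' = edgeIndex w q in suc k , s≤s k< , j'

  record ParentCertificate (T : Sub m) : Set where
    field
      rank : V m → ℕ
      parent : V m → V m
      root : V m
      rank-zero : ∀ v → rank v ≡ 0 → v ≡ root
      parent-lower : ∀ v → 0 < rank v → rank (parent v) < rank v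
      parent-edge : ∀ v → 0 < rank v → Σ (E m) λ e → T e ≡ true × Joins e v (parent v)
      edge-parent : ∀ e u w → T e ≡ true → Joins e u w →
                    (0 < rank u × parent u ≡ w) ⊎ (0 < rank w × parent w ≡ u)

  module _ {T : Sub m} (C : ParentCertificate T) where
    open ParentCertificate C

    walkToRoot : (k : ℕ) (v : V m) → rank v ≤ k → Walk T v root
    walkToRoot k v _ with rank v in eq
    ... | zero rewrite rank-zero v eq = []
    walkToRoot zero v () | suc _
    walkToRoot (suc k) v (s≤s r≤k) | suc r =
      let 0<rank = subst (0 <_) (sym eq) (s≤s z≤n)
          (e , te , j) = parent-edge v 0<rank
          lower = subst (rank (parent v) <_) eq (parent-lower v 0<rank)
      in step e te j (walkToRoot k (parent v) (≤-trans (≤-pred lower) r≤k))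

    certified⇒connected : Connected T
    certified⇒connected u v = walkToRoot _ u ≤-refl ++ʷ reverseʷ (walkToRoot _ v ≤-refl)

    EntersFromParent : ∀ {x y} → Walk T x y → Set
    EntersFromParent {x} {y} w =
      Σ (V m) λ z → parent y ≡ z × 0 < rank y × z ∈ vertsAll w × (z ≡ x → wlen w ≡ 1)

    keepsClimbing : ∀ {x v y} e (p : T e ≡ true) (j : Joins e x v) (w : Walk T v y) →
                    Simple (step e p j w) → parent v ≡ x → 0 < rank v →
                    rank x < rank y × EntersFromParent (step e p j w)
    keepsClimbing e p j [] _ pv rv =
      subst (λ z → rank z < _) pv (parent-lower _ rv) , (_ , pv , rv , here refl , λ _ → refl)
    keepsClimbing e p j (step e' p' j' w) (x∉ ∷ s) pv rv with edge-parent e' _ _ p' j'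
    ... | inj₁ (_ , pv') = ⊥-elim (All.lookup x∉ (there (subst (_∈ vertsAll w) (trans (sym pv') pv) (start∈ w))) refl)
    ... | inj₂ (rv' , pv') with keepsClimbing e' p' j' w s pv' rv'
    ...   | lt , (z , pz , ry , z∈ , _) =
      <-trans (subst (λ q → rank q < _) pv (parent-lower _ rv)) lt ,
      (z , pz , ry , there z∈ , λ z≡x → ⊥-elim (All.lookup x∉ z∈ (sym z≡x)))

    -- A simple walk first descends and, once it climbs, keeps climbing.
    descendsOrClimbs : ∀ {x y} (w : Walk T x y) → Simple w → rank y ≤ rank x ⊎ EntersFromParent w
    descendsOrClimbs [] _ = inj₁ ≤-refl
    descendsOrClimbs (step e p j w) s with edge-parent e _ _ p j
    descendsOrClimbs (step e p j w) s | inj₂ (rv , pv) = inj₂ (proj₂ (keepsClimbing e p j w s pv rv))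
    descendsOrClimbs (step e p j w) (x∉ ∷ s) | inj₁ (rx , px) with descendsOrClimbs w s
    ... | inj₁ le = inj₁ (<⇒≤ (≤-<-trans le (subst (λ q → rank q < _) px (parent-lower _ rx))))
    ... | inj₂ (z , pz , ry , z∈ , _) =
      inj₂ (z , pz , ry , there z∈ , λ z≡x → ⊥-elim (All.lookup x∉ z∈ (sym z≡x)))

    noReturnToParent : ∀ {u u₁} (w : Walk T u₁ u) → 2 ≤ wlen w → Simple w → 0 < rank u₁ → parent u₁ ≡ u → ⊥
    noReturnToParent (step e p j w) len s r₁ pu₁ with edge-parent e _ _ p j
    ... | inj₂ (r₂ , pv) = <-irrefl refl (<-trans (proj₁ (keepsClimbing e p j w s pv r₂))
                                                   (subst (λ q → rank q < _) pu₁ (parent-lower _ r₁)))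
    ... | inj₁ (_ , pv) with trans (sym pv) pu₁
    ...   | refl = closed-notSimple w (≤-pred len) (tail s)
      where
      tail : ∀ {v : V m} {l} → Unique (v ∷ l) → Unique l
      tail (_ ∷ t) = t

    certified⇒acyclic : ¬ Cycle T
    certified⇒acyclic (u , step e p j w , len , uniq) with edge-parent e _ _ p j
    ... | inj₂ (r₁ , pu₁) = noReturnToParent w (≤-pred len) (simple-fromInit w uniq) r₁ pu₁
    ... | inj₁ (r₀ , pu₀) with descendsOrClimbs w (simple-fromInit w uniq)
    ...   | inj₁ le = <-irrefl refl (≤-<-trans le (subst (λ q → rank q < _) pu₀ (parent-lower _ r₀)))
    ...   | inj₂ (z , pz , _ , _ , single) = <-irrefl refl (≤-trans (≤-pred len) (≤-reflexive (single (trans (sym pz) pu₀))))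

    certified⇒spanningTree : IsSpanningTree T
    certified⇒spanningTree = certified⇒connected , certified⇒acyclic

  TwoEdges : Sub m → V m → Set
  TwoEdges T v = Σ (E m) λ e → Σ (E m) λ e' → e ≢ e' × T e ≡ true × T e' ≡ true ×
                   incident e v ≡ true × incident e' v ≡ true

  ≟V-refl : ∀ (v : V m) → does (v ≟V v) ≡ true
  ≟V-refl v with v ≟V v
  ... | yes _ = refl
  ... | no v≢v = ⊥-elim (v≢v refl)

  joins⇒incident : ∀ {e v w} → Joins e v w → incident e v ≡ true
  joins⇒incident {e} {v} {w} (inj₁ p) rewrite p | ≟V-refl v = refl
  joins⇒incident {e} {v} {w} (inj₂ p) rewrite p | ≟V-refl v = ∨-zeroʳ _

  ∈allE : ∀ e → e ∈ allE m
  ∈allE (ab i j) = ∈-++⁺ˡ (∈-concatMap⁺ (λ i → map (ab i) (allFin m)) (Any.map (λ { refl → ∈-map⁺ (ab i) (∈-allFin j) }) (∈-allFin i)))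
  ∈allE t₁ = ∈-++⁺ʳ _ (here refl)
  ∈allE t₂ = ∈-++⁺ʳ _ (there (here refl))

  twoEdges⇒degree≥2 : ∀ T v → TwoEdges T v → 2 ≤ degree T v
  twoEdges⇒degree≥2 T v (e , e' , e≢e' , te , te' , ie , ie') =
    two≤sum (λ e → if T e ∧ incident e v then 1 else 0) (∈allE e) (∈allE e') e≢e'
      (cong (λ z → if z then 1 else 0) (trans (cong (_∧ _) te) ie))
      (cong (λ z → if z then 1 else 0) (trans (cong (_∧ _) te') ie'))

  leaf : Sub m → V m → ℕ
  leaf T v = if does (degree T v ℕ.≟ 1) then 1 else 0

  leaf≤1 : ∀ T v → leaf T v ≤ 1
  leaf≤1 T v with degree T v ℕ.≡ᵇ 1
  ... | true = ≤-refl
  ... | false = z≤n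

  twoEdges⇒notLeaf : ∀ T v → TwoEdges T v → leaf T v ≡ 0
  twoEdges⇒notLeaf T v two with degree T v | twoEdges⇒degree≥2 T v two
  ... | suc (suc _) | _ = refl
  ... | suc zero | s≤s ()

  indicator : V m → V m → ℕ
  indicator x y = if does (y ≟V x) then 1 else 0

  indicator-absent : ∀ x {L} → x ∉ L → sum (map (indicator x) L) ≡ 0
  indicator-absent x {[]} _ = refl
  indicator-absent x {y ∷ L} x∉ with y ≟V x
  ... | yes refl = ⊥-elim (x∉ (here refl))
  ... | no _ = indicator-absent x (x∉ ∘ there)

  indicator≤1 : ∀ x {L} → Unique L → sum (map (indicator x) L) ≤ 1
  indicator≤1 x {[]} _ = z≤n
  indicator≤1 x {y ∷ L} (y∉ ∷ u) with y ≟V x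
  ... | yes refl = ≤-reflexive (cong suc (indicator-absent y (λ y∈ → All.lookup y∉ y∈ refl)))
  ... | no _ = indicator≤1 x u

  allV-unique : Unique (allV m)
  allV-unique = ++⁺ (map⁺ a-injective (allFin⁺ _))
                    (++⁺ (map⁺ b-injective (allFin⁺ _)) ((((λ ()) ∷ []) ∷ ([] ∷ []))) b∉s) a∉rest
    where
    b∉s : ∀ {v} → v ∈ map b (allFin m) × v ∈ s₁ ∷ s₂ ∷ [] → ⊥
    b∉s (p , q) with ∈-map⁻ b p | q
    ... | _ , _ , refl | here ()
    ... | _ , _ , refl | there (here ())
    a∉rest : ∀ {v} → v ∈ map a (allFin (suc m)) × v ∈ map b (allFin m) ++ s₁ ∷ s₂ ∷ [] → ⊥
    a∉rest (p , q) with ∈-map⁻ a p | ∈-++⁻ (map b (allFin m)) q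
    ... | _ , _ , refl | inj₁ q' with ∈-map⁻ b q'
    ...   | _ , _ , ()
    a∉rest (p , q) | _ , _ , refl | inj₂ (here ())
    a∉rest (p , q) | _ , _ , refl | inj₂ (there (here ()))

  leaf≤indicators : ∀ T x → (∀ v → v ≢ s₁ → v ≢ s₂ → v ≢ x → TwoEdges T v) →
                    ∀ y → leaf T y ≤ indicator s₁ y + (indicator s₂ y + indicator x y)
  leaf≤indicators T x two y with y ≟V s₁ | y ≟V s₂ | y ≟V x
  ... | yes refl | _ | _ = ≤-trans (leaf≤1 T y) (m≤m+n 1 _)
  ... | no _ | yes refl | _ = ≤-trans (leaf≤1 T y) (m≤m+n 1 _)
  ... | no _ | no _ | yes refl = leaf≤1 T y
  ... | no y≢s₁ | no y≢s₂ | no y≢x = ≤-trans (≤-reflexive (twoEdges⇒notLeaf T y (two y y≢s₁ y≢s₂ y≢x))) z≤n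

  leaves≤3 : ∀ T x → (∀ v → v ≢ s₁ → v ≢ s₂ → v ≢ x → TwoEdges T v) → numLeaves T ≤ 3
  leaves≤3 T x two = begin
    sum (map (leaf T) (allV m))
      ≤⟨ sum-map-mono (leaf≤indicators T x two) (allV m) ⟩
    sum (map (λ y → indicator s₁ y + (indicator s₂ y + indicator x y)) (allV m))
      ≡⟨ sum-map-+ (indicator s₁) _ (allV m) ⟩
    sum (map (indicator s₁) (allV m)) + sum (map (λ y → indicator s₂ y + indicator x y) (allV m))
      ≡⟨ cong (sum (map (indicator s₁) (allV m)) +_) (sum-map-+ (indicator s₂) (indicator x) (allV m)) ⟩
    sum (map (indicator s₁) (allV m)) + (sum (map (indicator s₂) (allV m)) + sum (map (indicator x) (allV m)))
      ≤⟨ +-mono-≤ (indicator≤1 s₁ allV-unique) (+-mono-≤ (indicator≤1 s₂ allV-unique) (indicator≤1 x allV-unique)) ⟩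
    3 ∎
    where open ≤-Reasoning

  flipSub : Sub m → E m → E m → Sub m
  flipSub T e₁ e₂ e = (T e ∧ not (does (e ≟E e₁))) ∨ does (e ≟E e₂)

  flipSub-sound : ∀ T e₁ e₂ e → flipSub T e₁ e₂ e ≡ true → (T e ≡ true × e ≢ e₁) ⊎ e ≡ e₂
  flipSub-sound T e₁ e₂ e h with e ≟E e₂ | e ≟E e₁ | T e
  ... | yes e≡e₂ | _ | _ = inj₂ e≡e₂
  ... | no _ | no e≢e₁ | true = inj₁ (refl , e≢e₁)
  flipSub-sound T e₁ e₂ e () | no _ | yes _ | true
  flipSub-sound T e₁ e₂ e () | no _ | _ | false

  flipSub-complete : ∀ T e₁ e₂ e → (T e ≡ true × e ≢ e₁) ⊎ e ≡ e₂ → flipSub T e₁ e₂ e ≡ true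
  flipSub-complete T e₁ e₂ e h with e ≟E e₂ | e ≟E e₁ | h
  ... | yes _ | _ | _ = ∨-zeroʳ _
  ... | no e≢e₂ | _ | inj₂ e≡e₂ = ⊥-elim (e≢e₂ e≡e₂)
  ... | no _ | yes e≡e₁ | inj₁ (_ , e≢e₁) = ⊥-elim (e≢e₁ e≡e₁)
  ... | no _ | no _ | inj₁ (te , _) rewrite te = refl

  flipSub-isFlip : ∀ T e₁ e₂ → T e₁ ≡ true → EdgeFlip T (flipSub T e₁ e₂)
  flipSub-isFlip T e₁ e₂ te₁ =
    e₁ , e₂ , te₁ , flipSub-complete T e₁ e₂ e₂ (inj₂ refl) ,
    λ e → flipSub-sound T e₁ e₂ e , flipSub-complete T e₁ e₂ e

module Orderings {m : ℕ} (a₁ a₂ : Fin (suc m)) where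
  open 𝓑 a₁ a₂
  open Graph a₁ a₂

  record Ordering (n : ℕ) : Set where
    field
      at : ℕ → V m
      pos : V m → ℕ
      pos≤n : ∀ v → pos v ≤ n
      at-pos : ∀ v → at (pos v) ≡ v
      pos-at : ∀ k → k ≤ n → pos (at k) ≡ k
      at-0 : at 0 ≡ s₁
      at-n : at n ≡ s₂
      at-1 : at 1 ≡ a a₁
      at-pred-n : ∀ k → suc k ≡ n → at k ≡ a a₂
      parity : ∀ k → k ≤ n → isA (at k) ≡ odd k

  Realises : ∀ {n} → Ordering n → Sub m → (ℕ → ℕ → Set) → Set
  Realises o T R = ∀ e → (T e ≡ true → R (pos (proj₁ (ends e))) (pos (proj₂ (ends e)))) ×
                         (R (pos (proj₁ (ends e))) (pos (proj₂ (ends e))) → T e ≡ true)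
    where open Ordering o

  realises-⇔ : ∀ {n} {o : Ordering n} {T} {R R' : ℕ → ℕ → Set} →
               (∀ {P Q} → R P Q → R' P Q) → (∀ {P Q} → R' P Q → R P Q) →
               Realises o T R → Realises o T R'
  realises-⇔ to from tr e = to ∘ proj₁ (tr e) , proj₂ (tr e) ∘ from

  module OrderingFacts {n : ℕ} (o : Ordering n) where
    open Ordering o

    at-injective : ∀ {k k'} → k ≤ n → k' ≤ n → at k ≡ at k' → k ≡ k'
    at-injective {k} {k'} k≤n k'≤n eq = trans (sym (pos-at k k≤n)) (trans (cong pos eq) (pos-at k' k'≤n))

    inner-notEnd : ∀ {k} → 0 < k → k < n → at k ≢ s₁ × at k ≢ s₂
    inner-notEnd {k} 0<k k<n =
      (λ eq → <⇒≢ 0<k (sym (at-injective (<⇒≤ k<n) z≤n (trans eq (sym at-0))))) ,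
      (λ eq → <⇒≢ k<n (at-injective (<⇒≤ k<n) ≤-refl (trans eq (sym at-n))))

    endPositions : ∀ {e u w} → Joins e u w →
                   Pair (pos (proj₁ (ends e))) (pos (proj₂ (ends e))) (pos u) (pos w)
    endPositions (inj₁ p) rewrite p = inj₁ (refl , refl)
    endPositions (inj₂ p) rewrite p = inj₂ (refl , refl)

    realises-joins : ∀ {T R} → Realises o T R → (∀ {P Q} → R P Q → R Q P) → ∀ {e u w} → Joins e u w →
                     (T e ≡ true → R (pos u) (pos w)) × (R (pos u) (pos w) → T e ≡ true)
    realises-joins {T} {R} tr R-sym {e} j with endPositions j
    ... | inj₁ (p , q) = (λ t → subst₂ R p q (proj₁ (tr e) t)) ,
                         (λ r → proj₂ (tr e) (subst₂ R (sym p) (sym q) r))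
    ... | inj₂ (p , q) = (λ t → R-sym (subst₂ R p q (proj₁ (tr e) t))) ,
                         (λ r → proj₂ (tr e) (subst₂ R (sym p) (sym q) (R-sym r)))

    edge≡⇔pair : ∀ {e e' x y} → x ≤ n → y ≤ n → Joins e' (at x) (at y) →
                 (e ≡ e' → Pair (pos (proj₁ (ends e))) (pos (proj₂ (ends e))) x y) ×
                 (Pair (pos (proj₁ (ends e))) (pos (proj₂ (ends e))) x y → e ≡ e')
    edge≡⇔pair {e} {e'} {x} {y} x≤n y≤n j = sound , complete
      where
      sound : e ≡ e' → Pair _ _ x y
      sound refl with endPositions j
      ... | inj₁ (p , q) = inj₁ (trans p (pos-at x x≤n) , trans q (pos-at y y≤n))
      ... | inj₂ (p , q) = inj₂ (trans p (pos-at y y≤n) , trans q (pos-at x x≤n))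
      atPos : ∀ {v k} → pos v ≡ k → v ≡ at k
      atPos p = trans (sym (at-pos _)) (cong at p)
      complete : Pair _ _ x y → e ≡ e'
      complete (inj₁ (p , q)) = joins-unique (inj₁ (cong₂ _,_ (atPos p) (atPos q))) j
      complete (inj₂ (p , q)) = joins-unique (inj₂ (cong₂ _,_ (atPos p) (atPos q))) j

    innerEdge : ∀ x y → 0 < x → x < n → 0 < y → y < n → odd y ≡ not (odd x) →
                Σ (E m) λ e → Joins e (at x) (at y)
    innerEdge x y 0<x x<n 0<y y<n oy =
      crossEdge (at x) (at y) sides (proj₁ notEnd-x) (proj₂ notEnd-x) (proj₁ notEnd-y) (proj₂ notEnd-y)
      where
      notEnd-x = inner-notEnd 0<x x<n
      notEnd-y = inner-notEnd 0<y y<n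
      sides : isA (at x) ≡ not (isA (at y))
      sides = trans (parity x (<⇒≤ x<n))
                (trans (sym (not-involutive (odd x))) (cong not (trans (sym oy) (sym (parity y (<⇒≤ y<n))))))

    consecutiveEdge : ∀ k → suc k ≤ n → Σ (E m) λ e → Joins e (at k) (at (suc k))
    consecutiveEdge zero _ rewrite at-0 | at-1 = t₁ , inj₁ refl
    consecutiveEdge (suc k) k+2≤n with suc (suc k) ℕ.≟ n
    ... | yes k+2≡n = t₂ , inj₂ (cong₂ _,_ (sym (trans (cong at k+2≡n) at-n)) (sym (at-pred-n (suc k) k+2≡n)))
    ... | no k+2≢n = innerEdge (suc k) (suc (suc k)) (s≤s z≤n) k+2≤n (s≤s z≤n) (≤∧≢⇒< k+2≤n k+2≢n) refl

    flip-realises : ∀ {T R e₁ e₂ x₁ y₁ x₂ y₂} → x₁ ≤ n → y₁ ≤ n → x₂ ≤ n → y₂ ≤ n →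
                    Joins e₁ (at x₁) (at y₁) → Joins e₂ (at x₂) (at y₂) → Realises o T R →
                    Realises o (flipSub T e₁ e₂) (λ P Q → (R P Q × ¬ Pair P Q x₁ y₁) ⊎ Pair P Q x₂ y₂)
    flip-realises {T} {R} {e₁} {e₂} x₁≤n y₁≤n x₂≤n y₂≤n j₁ j₂ tr e = sound , complete
      where
      is₁ = edge≡⇔pair {e} x₁≤n y₁≤n j₁
      is₂ = edge≡⇔pair {e} x₂≤n y₂≤n j₂
      sound : flipSub T e₁ e₂ e ≡ true → _
      sound t with flipSub-sound T e₁ e₂ e t
      ... | inj₁ (te , e≢e₁) = inj₁ (proj₁ (tr e) te , e≢e₁ ∘ proj₂ is₁)
      ... | inj₂ e≡e₂ = inj₂ (proj₁ is₂ e≡e₂)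
      complete : _ → flipSub T e₁ e₂ e ≡ true
      complete (inj₁ (r , np)) = flipSub-complete T e₁ e₂ e (inj₁ (proj₂ (tr e) r , np ∘ proj₁ is₁))
      complete (inj₂ pr) = flipSub-complete T e₁ e₂ e (inj₂ (proj₂ is₂ pr))

    module BrokenPathTree (T : Sub m) (c d : ℕ) (d≤c : d ≤ c) (c<n : c < n) (ed : E m)
                          (jd : Joins ed (at d) (at (suc c))) (tr : Realises o T (BrokenPath c d)) where

      parentOf : V m → V m
      parentOf v with pos v ℕ.≟ suc c
      ... | yes _ = at d
      ... | no _ = at (pred (pos v))

      parentOf-jump : ∀ v → pos v ≡ suc c → parentOf v ≡ at d
      parentOf-jump v eq with pos v ℕ.≟ suc c
      ... | yes _ = refl
      ... | no ne = ⊥-elim (ne eq)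

      parentOf-step : ∀ v → pos v ≢ suc c → parentOf v ≡ at (pred (pos v))
      parentOf-step v ne with pos v ℕ.≟ suc c
      ... | yes eq = ⊥-elim (ne eq)
      ... | no _ = refl

      d≤n : d ≤ n
      d≤n = ≤-trans d≤c (<⇒≤ c<n)

      related : ∀ {e u w} → Joins e u w →
                (T e ≡ true → BrokenPath c d (pos u) (pos w)) × (BrokenPath c d (pos u) (pos w) → T e ≡ true)
      related = realises-joins tr (λ {P} {Q} → brokenPath-sym {c} {d} {P} {Q})

      jumpEdge∈T : T ed ≡ true
      jumpEdge∈T = proj₂ (related jd) (inj₂ (inj₁ (pos-at d d≤n , pos-at (suc c) c<n)))

      pathEdge∈T : ∀ k (k<n : suc k ≤ n) → k ≢ c → T (proj₁ (consecutiveEdge k k<n)) ≡ true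
      pathEdge∈T k k<n k≢c = proj₂ (related (proj₂ (consecutiveEdge k k<n)))
        (inj₁ (inj₁ (trans (cong suc (pos-at k (<⇒≤ k<n))) (sym (pos-at (suc k) k<n))) ,
               λ pr → pathEdge-injective k≢c
                        (subst₂ (λ P Q → Pair P Q c (suc c)) (pos-at k (<⇒≤ k<n)) (pos-at (suc k) k<n) pr)))

      parentEdge : ∀ v → 0 < pos v → Σ (E m) λ e → T e ≡ true × Joins e v (parentOf v)
      parentEdge v 0<p with pos v ℕ.≟ suc c
      ... | yes eq = ed , jumpEdge∈T ,
          subst (λ z → Joins ed z (at d)) (trans (cong at (sym eq)) (at-pos v)) (joins-sym jd)
      ... | no ne =
        let k = pred (pos v)
            sk≡p = suc-pred (pos v) {{>-nonZero 0<p}}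
            k<n = subst (_≤ n) (sym sk≡p) (pos≤n v)
            (e , j) = consecutiveEdge k k<n
        in e , pathEdge∈T k k<n (λ k≡c → ne (trans (sym sk≡p) (cong suc k≡c))) ,
           subst (λ z → Joins e z (at k)) (trans (cong at sk≡p) (at-pos v)) (joins-sym j)

      parentLower : ∀ v → 0 < pos v → pos (parentOf v) < pos v
      parentLower v 0<p with pos v ℕ.≟ suc c
      ... | yes eq rewrite pos-at d d≤n | eq = s≤s d≤c
      ... | no ne =
        let sk≡p = suc-pred (pos v) {{>-nonZero 0<p}} in
        subst (_< pos v) (sym (pos-at (pred (pos v)) (≤-trans (n≤1+n _) (subst (_≤ n) (sym sk≡p) (pos≤n v)))))
              (≤-reflexive sk≡p)

      edgeParent : ∀ e u w → T e ≡ true → Joins e u w →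
                   (0 < pos u × parentOf u ≡ w) ⊎ (0 < pos w × parentOf w ≡ u)
      edgeParent e u w te j with proj₁ (related j) te
      ... | inj₂ (inj₁ (pu , pw)) = inj₂ (subst (0 <_) (sym pw) (s≤s z≤n) ,
                                        trans (parentOf-jump w pw) (trans (cong at (sym pu)) (at-pos u)))
      ... | inj₂ (inj₂ (pu , pw)) = inj₁ (subst (0 <_) (sym pu) (s≤s z≤n) ,
                                        trans (parentOf-jump u pu) (trans (cong at (sym pw)) (at-pos w)))
      ... | inj₁ (inj₁ sp , np) = inj₂ (subst (0 <_) sp (s≤s z≤n) , stepsBack (pos w ℕ.≟ suc c))
        where
        stepsBack : Dec (pos w ≡ suc c) → parentOf w ≡ u
        stepsBack (yes eq) = ⊥-elim (np (inj₁ (suc-injective (trans sp eq) , eq)))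
        stepsBack (no ne) = trans (parentOf-step w ne) (trans (cong (at ∘ pred) (sym sp)) (at-pos u))
      ... | inj₁ (inj₂ sp , np) = inj₁ (subst (0 <_) sp (s≤s z≤n) , stepsBack (pos u ℕ.≟ suc c))
        where
        stepsBack : Dec (pos u ≡ suc c) → parentOf u ≡ w
        stepsBack (yes eq) = ⊥-elim (np (inj₂ (eq , suc-injective (trans sp eq))))
        stepsBack (no ne) = trans (parentOf-step u ne) (trans (cong (at ∘ pred) (sym sp)) (at-pos w))

      certificate : ParentCertificate T
      certificate = record
        { rank = pos ; parent = parentOf ; root = s₁
        ; rank-zero = λ v eq → trans (sym (at-pos v)) (trans (cong at eq) at-0)
        ; parent-lower = parentLower
        ; parent-edge = parentEdge
        ; edge-parent = edgeParent }

      -- Any other vertex has its parent edge and the edge to its successor.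
      twoEdges : ∀ v → v ≢ s₁ → v ≢ s₂ → v ≢ at c → TwoEdges T v
      twoEdges v v≢s₁ v≢s₂ v≢c =
        let k = pos v
            0<k = ≤∧≢⇒< z≤n (λ eq → v≢s₁ (trans (sym (at-pos v)) (trans (cong at (sym eq)) at-0)))
            k<n = ≤∧≢⇒< (pos≤n v) (λ eq → v≢s₂ (trans (sym (at-pos v)) (trans (cong at eq) at-n)))
            (e↓ , te↓ , j↓) = parentEdge v 0<k
            (e↑ , j↑₀) = consecutiveEdge k k<n
            j↑ : Joins e↑ v (at (suc k))
            j↑ = subst (λ z → Joins e↑ z (at (suc k))) (at-pos v) j↑₀
            te↑ = pathEdge∈T k k<n (λ eq → v≢c (trans (sym (at-pos v)) (cong at eq)))
            distinct : e↓ ≢ e↑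
            distinct e↓≡e↑ =
              let parent≡succ = joins-otherEnd j↓ (subst (λ z → Joins z v (at (suc k))) (sym e↓≡e↑) j↑)
              in 1+n≰n (≤-trans (n≤1+n _) (subst (λ z → suc z ≤ k) (pos-at (suc k) k<n)
                                             (subst (λ z → suc (pos z) ≤ k) parent≡succ (parentLower v 0<k))))
        in e↓ , e↑ , distinct , te↓ , te↑ , joins⇒incident j↓ , joins⇒incident j↑

      brokenPath-tree : IsSpanningTree T × numLeaves T ≤ 3
      brokenPath-tree = certified⇒spanningTree certificate , leaves≤3 T (at c) twoEdges

    path-tree : 0 < n → ∀ T → Realises o T Consecutive → IsSpanningTree T × numLeaves T ≤ 3
    path-tree 0<n T tr =
      BrokenPathTree.brokenPath-tree T 0 0 z≤n 0<n (proj₁ e₀) (proj₂ e₀)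
        (realises-⇔ {o = o} (λ {P} {Q} → consecutive⇒unbroken {0} {P} {Q}) (λ {P} {Q} → unbroken⇒consecutive {0} {P} {Q}) tr)
      where e₀ = consecutiveEdge 0 0<n

  module SwapMove {n : ℕ} (o : Ordering n) (i : ℕ) (1≤i : 1 ≤ i) (room : 5 + i ≤ n) where
    open Ordering o
    open Transposition i

    inner : ∀ k → k < 5 + i → k < n
    inner k k<5+i = ≤-trans k<5+i room

    i<n : i < n
    i<n = inner i (s≤s (m≤n+m i 4))

    c₁<n : c₁ < n
    c₁<n = inner c₁ (s≤s (s≤s (m≤n+m i 3)))

    c₂<n : c₂ < n
    c₂<n = inner c₂ (s≤s (s≤s (s≤s (s≤s (m≤n+m i 1)))))

    4+i<n : 4 + i < n
    4+i<n = inner (4 + i) ≤-refl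

    c₂<pred-n : ∀ k → suc k ≡ n → c₂ < k
    c₂<pred-n k e = ℕ.s≤s⁻¹ (subst (5 + i ≤_) (sym e) room)

    c₁<c₂ : c₁ < c₂
    c₁<c₂ = s≤s (n≤1+n (suc i))

    swapped : Ordering n
    swapped = record
      { at = at ∘ σ
      ; pos = σ ∘ pos
      ; pos≤n = λ v → σ-bounded (pos v) (pos≤n v) (<⇒≤ c₂<n)
      ; at-pos = λ v → trans (cong at (σ-involutive (pos v))) (at-pos v)
      ; pos-at = λ k k≤n → trans (cong σ (pos-at (σ k) (σ-bounded k k≤n (<⇒≤ c₂<n)))) (σ-involutive k)
      ; at-0 = trans (cong at (σ-fixed 0 (λ ()) (λ ()))) at-0
      ; at-n = trans (cong at (σ-fixed n (<⇒≢ c₁<n ∘ sym) (<⇒≢ c₂<n ∘ sym))) at-n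
      ; at-1 = trans (cong at (σ-fixed 1 (<⇒≢ (s≤s 1≤i)) (λ ()))) at-1
      ; at-pred-n = λ k e → trans (cong at (σ-fixed k (<⇒≢ (<-trans c₁<c₂ (c₂<pred-n k e)) ∘ sym)
                                                    (<⇒≢ (c₂<pred-n k e) ∘ sym))) (at-pred-n k e)
      ; parity = λ k k≤n → trans (parity (σ k) (σ-bounded k k≤n (<⇒≤ c₂<n))) (σ-parity k)
      }

    renumber : ∀ {T R} → Realises o T R → Realises swapped T (λ P Q → R (σ P) (σ Q))
    renumber {T} {R} tr e =
      (λ t → subst₂ R (sym (σ-involutive _)) (sym (σ-involutive _)) (proj₁ (tr e) t)) ,
      (λ r → proj₂ (tr e) (subst₂ R (σ-involutive _) (σ-involutive _) r))

    module Old = OrderingFacts o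
    module New = OrderingFacts swapped

    E₁ = Old.consecutiveEdge i i<n
    E₂ = Old.innerEdge i c₂ 1≤i i<n (s≤s z≤n) c₂<n (cong not (odd-2+ i))
    E₃ = Old.consecutiveEdge c₂ c₂<n
    E₄ = Old.innerEdge c₁ (4 + i) (s≤s z≤n) c₁<n (s≤s z≤n) 4+i<n (odd-2+ (2 + i))

    e₁ e₂ e₃ e₄ : E m
    e₁ = proj₁ E₁
    e₂ = proj₁ E₂
    e₃ = proj₁ E₃
    e₄ = proj₁ E₄

    J₁ : Joins e₁ (at (σ i)) (at (σ c₂))
    J₁ = subst₂ (Joins e₁) (cong at (sym σ-i)) (cong at (sym σ-c₂)) (proj₂ E₁)
    J₂ : Joins e₂ (at (σ i)) (at (σ c₁))
    J₂ = subst₂ (Joins e₂) (cong at (sym σ-i)) (cong at (sym σ-c₁)) (proj₂ E₂)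
    J₃ : Joins e₃ (at (σ c₁)) (at (σ (4 + i)))
    J₃ = subst₂ (Joins e₃) (cong at (sym σ-c₁)) (cong at (sym σ-4+i)) (proj₂ E₃)
    J₄ : Joins e₄ (at (σ c₂)) (at (σ (4 + i)))
    J₄ = subst₂ (Joins e₄) (cong at (sym σ-c₂)) (cong at (sym σ-4+i)) (proj₂ E₄)

    swap : ∀ T₀ → Realises o T₀ Consecutive →
           Σ (Sub m) λ T₂ → Realises swapped T₂ Consecutive × (∀ {T'} → FlipSeq≤3 T₂ T' → FlipSeq≤3 T₀ T')
    swap T₀ tr₀ = T₂ , tr₂ , extend
      where
      T₁ T₂ : Sub m
      T₁ = flipSub T₀ e₁ e₂
      T₂ = flipSub T₁ e₃ e₄

      tr₁ : Realises swapped T₁ (BrokenPath c₂ c₁)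
      tr₁ = realises-⇔ {o = swapped} (λ {P} {Q} → firstFlip⇒broken P Q) (λ {P} {Q} → broken⇒firstFlip P Q)
              (New.flip-realises {R = λ P Q → Consecutive (σ P) (σ Q)} (<⇒≤ i<n) (<⇒≤ c₂<n) (<⇒≤ i<n) (<⇒≤ c₁<n) J₁ J₂ (renumber {R = Consecutive} tr₀))

      tr₂ : Realises swapped T₂ Consecutive
      tr₂ = realises-⇔ {o = swapped} (λ {P} {Q} → secondFlip⇒consecutive {P} {Q}) (λ {P} {Q} → consecutive⇒secondFlip {P} {Q})
              (New.flip-realises {R = BrokenPath c₂ c₁} (<⇒≤ c₁<n) (<⇒≤ 4+i<n) (<⇒≤ c₂<n) (<⇒≤ 4+i<n) J₃ J₄ tr₁)

      e₁∈T₀ : T₀ e₁ ≡ true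
      e₁∈T₀ = proj₂ (Old.realises-joins {R = Consecutive} tr₀ (λ {P} {Q} → consecutive-sym {P} {Q}) (proj₂ E₁))
                    (inj₁ (trans (cong suc (pos-at i (<⇒≤ i<n))) (sym (pos-at c₁ (<⇒≤ c₁<n)))))

      e₃∈T₁ : T₁ e₃ ≡ true
      e₃∈T₁ = proj₂ (New.realises-joins tr₁ (λ {P} {Q} → brokenPath-sym {c₂} {c₁} {P} {Q}) J₃)
                    (inj₂ (inj₁ (Ordering.pos-at swapped c₁ (<⇒≤ c₁<n) , Ordering.pos-at swapped (4 + i) (<⇒≤ 4+i<n))))

      extend : ∀ {T'} → FlipSeq≤3 T₂ T' → FlipSeq≤3 T₀ T'
      extend rest =
        flip (flipSub-isFlip T₀ e₁ e₂ e₁∈T₀) (proj₁ tree₁) (proj₂ tree₁)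
          (flip (flipSub-isFlip T₁ e₃ e₄ e₃∈T₁) (proj₁ tree₂) (proj₂ tree₂) rest)
        where
        tree₁ = New.BrokenPathTree.brokenPath-tree T₁ c₂ c₁ (<⇒≤ c₁<c₂) c₂<n e₃ J₃ tr₁
        tree₂ = New.path-tree (≤-trans (s≤s z≤n) i<n) T₂ tr₂

  module Sorting {N : ℕ} (target : Ordering (suc N)) (P₂ : Sub m) (trP₂ : Realises target P₂ Consecutive) where
    module Target = Ordering target

    Agree : Ordering (suc N) → ℕ → Set
    Agree o k = ∀ k' → k' < k → Ordering.at o k' ≡ Target.at k'

    -- Agreeing before position N is agreeing everywhere (positions N and N+1
    -- hold a a₂ and s₂), so the realised path is the target path.
    agree⇒done : ∀ o T → Realises o T Consecutive → Agree o N → FlipSeq≤3 T P₂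
    agree⇒done o T tr ag = done λ e →
      ⇔→≡ {z = true} (mk⇔ (λ t → proj₂ (trP₂ e) (subst₂ Consecutive (samePos _) (samePos _) (proj₁ (tr e) t)))
                          (λ t → proj₂ (tr e) (subst₂ Consecutive (sym (samePos _)) (sym (samePos _)) (proj₁ (trP₂ e) t))))
      where
      open Ordering o
      agreeAll : ∀ k → k ≤ suc N → at k ≡ Target.at k
      agreeAll k k≤n with k ℕ.≟ suc N | k ℕ.≟ N
      ... | yes refl | _ = trans at-n (sym Target.at-n)
      ... | no _ | yes refl = trans (at-pred-n N refl) (sym (Target.at-pred-n N refl))
      ... | no k≢n | no k≢N = ag k (≤∧≢⇒< (ℕ.s≤s⁻¹ (≤∧≢⇒< k≤n k≢n)) k≢N)
      samePos : ∀ v → pos v ≡ Target.pos v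
      samePos v = trans (cong pos (sym (trans (agreeAll (Target.pos v) (Target.pos≤n v)) (Target.at-pos v))))
                        (pos-at (Target.pos v) (Target.pos≤n v))

    Sortable : ℕ → Set
    Sortable k = ∀ (o : Ordering (suc N)) T → Realises o T Consecutive → Agree o k → FlipSeq≤3 T P₂

    bringForward : ∀ k₀ → 1 ≤ k₀ → Sortable (2 + k₀) → ∀ d (o : Ordering (suc N)) T →
                   Realises o T Consecutive → Agree o (suc k₀) →
                   Ordering.pos o (Target.at (suc k₀)) ≡ twice d + suc k₀ →
                   2 + Ordering.pos o (Target.at (suc k₀)) ≤ suc N → FlipSeq≤3 T P₂
    bringForward k₀ 1≤k₀ next zero o T tr ag eq _ = next o T tr agree
      where
      agree : Agree o (2 + k₀)
      agree k' k'<2+k₀ with k' ℕ.≟ suc k₀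
      ... | yes refl = trans (cong (Ordering.at o) (sym eq)) (Ordering.at-pos o _)
      ... | no k'≢1+k₀ = ag k' (≤∧≢⇒< (ℕ.s≤s⁻¹ k'<2+k₀) k'≢1+k₀)
    bringForward k₀ 1≤k₀ next (suc d) o T tr ag eq fits =
      proj₂ (proj₂ moved) (bringForward k₀ 1≤k₀ next d Swap.swapped (proj₁ moved) (proj₁ (proj₂ moved)) agree eq' fits')
      where
      i = twice d + k₀
      open Transposition i
      pos-t : Ordering.pos o (Target.at (suc k₀)) ≡ c₂
      pos-t = trans eq (cong (suc ∘ suc) (+-suc (twice d) k₀))
      room : 5 + i ≤ suc N
      room = subst (λ z → 2 + z ≤ suc N) pos-t fits
      module Swap = SwapMove o i (≤-trans 1≤k₀ (m≤n+m k₀ (twice d))) room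
      moved = Swap.swap T tr
      newPos-t : σ (Ordering.pos o (Target.at (suc k₀))) ≡ c₁
      newPos-t = trans (cong σ pos-t) σ-c₂
      eq' : σ (Ordering.pos o (Target.at (suc k₀))) ≡ twice d + suc k₀
      eq' = trans newPos-t (sym (+-suc (twice d) k₀))
      fits' : 2 + σ (Ordering.pos o (Target.at (suc k₀))) ≤ suc N
      fits' = subst (λ z → 2 + z ≤ suc N) (sym newPos-t) (≤-trans (n≤1+n _) (≤-trans (n≤1+n _) room))
      agree : Agree Swap.swapped (suc k₀)
      agree k' k'<1+k₀ =
        let k'<c₁ = ≤-trans k'<1+k₀ (s≤s (m≤n+m k₀ (twice d)))
        in trans (cong (Ordering.at o) (σ-fixed k' (<⇒≢ k'<c₁) (<⇒≢ (<-trans k'<c₁ Swap.c₁<c₂)))) (ag k' k'<1+k₀)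

    sortFrom : ∀ f k₀ → 1 ≤ k₀ → f + suc k₀ ≡ N → Sortable (suc k₀)
    sortFrom zero k₀ _ refl o T tr ag = agree⇒done o T tr ag
    sortFrom (suc f) k₀ 1≤k₀ f+k≡N o T tr ag =
      bringForward k₀ 1≤k₀ (sortFrom f (suc k₀) (≤-trans 1≤k₀ (n≤1+n k₀)) (trans (+-suc f (suc k₀)) f+k≡N))
                   (proj₁ gap) o T tr ag pos≡ fits
      where
      open Ordering o
      k = suc k₀
      t = Target.at k
      p = pos t
      k<N : k < N
      k<N = subst (k <_) f+k≡N (s≤s (m≤n+m k f))
      k≤n : k ≤ suc N
      k≤n = ≤-trans (<⇒≤ k<N) (n≤1+n N)
      -- positions before k already hold the target's earlier vertices
      k≤p : k ≤ p
      k≤p with p ℕ.<? k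
      ... | no p≮k = ≮⇒≥ p≮k
      ... | yes p<k = ⊥-elim (<-irrefl (OrderingFacts.at-injective target (pos≤n t) k≤n
                                          (trans (sym (ag p p<k)) (at-pos t))) p<k)
      -- in both orderings t sits at a position of the parity of its side
      sameParity : odd k ≡ odd (p ∸ k + k)
      sameParity = trans (sym (Target.parity k k≤n))
                     (trans (cong isA (sym (at-pos t))) (trans (parity p (pos≤n t)) (cong odd (sym (m∸n+n≡m k≤p)))))
      gap = sameParity⇒even (p ∸ k) k sameParity
      pos≡ : p ≡ twice (proj₁ gap) + k
      pos≡ = trans (sym (m∸n+n≡m k≤p)) (cong (_+ k) (proj₂ gap))
      -- t is neither s₂ nor a a₂, which sit at the last two positions
      p≢n : p ≢ suc N
      p≢n e = <⇒≢ (≤-trans k<N (n≤1+n N))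
                (OrderingFacts.at-injective target k≤n ≤-refl (trans (sym (at-pos t)) (trans (cong at e) (trans at-n (sym Target.at-n)))))
      p≢N : p ≢ N
      p≢N e = <⇒≢ k<N (OrderingFacts.at-injective target k≤n (n≤1+n N)
                (trans (sym (at-pos t)) (trans (cong at e) (trans (at-pred-n N refl) (sym (Target.at-pred-n N refl))))))
      fits : 2 + p ≤ suc N
      fits = s≤s (≤∧≢⇒< (ℕ.s≤s⁻¹ (≤∧≢⇒< (pos≤n t) p≢n)) p≢N)

  module FromHamPath {P : Sub m} (ham : IsHamPath P s₁ s₂) where
    w = proj₁ ham
    n = wlen w

    covers : (v : V m) → v ∈ vertsAll w
    covers = proj₁ (proj₂ (proj₂ ham))

    pos : V m → ℕ
    pos v = indexOf (covers v)

    membership-irrelevant : ∀ {v} (p q : v ∈ vertsAll w) → p ≡ q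
    membership-irrelevant = unique⇒irrelevant (setoid (V m)) (Decidable⇒UIP.≡-irrelevant _≟V_) (proj₁ (proj₂ ham))

    secondVertex : ∀ (path : Walk P s₁ s₂) → vertexAt path 1 ≡ a a₁
    secondVertex (step _ _ j _) = s₁-neighbour j

    alternates : ∀ k → k ≤ n → isA (vertexAt w k) ≡ odd k
    alternates zero _ = refl
    alternates (suc k) k< = trans (isA-joins (proj₂ (proj₂ (stepEdge w k k<)))) (cong not (alternates k (<⇒≤ k<)))

    ordering : Ordering n
    ordering = record
      { at = vertexAt w
      ; pos = pos
      ; pos≤n = λ v → index≤wlen w (covers v)
      ; at-pos = λ v → vertexAt-index w (covers v)
      ; pos-at = λ k k≤n → let q , eq = vertexAt-member w k k≤n in trans (cong indexOf (membership-irrelevant _ q)) eq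
      ; at-0 = refl
      ; at-n = vertexAt-end w
      ; at-1 = secondVertex w
      ; at-pred-n = λ k eq → s₂-neighbour (subst (Joins _ _) (trans (cong (vertexAt w) eq) (vertexAt-end w))
                                                (proj₂ (proj₂ (stepEdge w k (≤-reflexive eq)))))
      ; parity = alternates
      }

    open OrderingFacts ordering using (endPositions)
    open Ordering ordering using (at-pos; pos-at; pos≤n)

    realises : Realises ordering P Consecutive
    realises e = sound , complete
      where
      u = proj₁ (ends e)
      v = proj₂ (ends e)
      sound : P e ≡ true → Consecutive (pos u) (pos v)
      sound pe with edgeIndex w (proj₂ (proj₂ (proj₂ ham)) e pe)
      ... | k , k< , j with endPositions j
      ...   | inj₁ (p₁ , p₂) = inj₁ (trans (cong suc (trans p₁ (pos-at k (<⇒≤ k<)))) (sym (trans p₂ (pos-at (suc k) k<))))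
      ...   | inj₂ (p₁ , p₂) = inj₂ (trans (cong suc (trans p₂ (pos-at k (<⇒≤ k<)))) (sym (trans p₁ (pos-at (suc k) k<))))
      stepIsEdge : ∀ {x y} → suc (pos x) ≡ pos y → Joins e x y → P e ≡ true
      stepIsEdge {x} {y} sp j =
        let k< = subst (_≤ n) (sym sp) (pos≤n y)
            e' , pe' , j' = stepEdge w (pos x) k<
            j'' = subst₂ (Joins e') (at-pos x) (trans (cong (vertexAt w) sp) (at-pos y)) j'
        in subst (λ z → P z ≡ true) (joins-unique j'' j) pe'
      complete : Consecutive (pos u) (pos v) → P e ≡ true
      complete (inj₁ sp) = stepIsEdge sp (inj₁ refl)
      complete (inj₂ sp) = stepIsEdge sp (inj₂ refl)

  -- Orderings are bijections V m ≅ {0, …, n}, so all have the same length.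
  length≤ : ∀ {n₁ n₂} → Ordering n₁ → Ordering n₂ → n₁ ≤ n₂
  length≤ {n₁} {n₂} o₁ o₂ = ℕ.s≤s⁻¹ (FP.injective⇒≤ {f = f} f-injective)
    where
    module O₁ = Ordering o₁
    module O₂ = Ordering o₂
    f : Fin (suc n₁) → Fin (suc n₂)
    f k = fromℕ< (s≤s (O₂.pos≤n (O₁.at (toℕ k))))
    f-injective : ∀ {x y} → f x ≡ f y → x ≡ y
    f-injective {x} {y} e =
      let samePos = trans (sym (FP.toℕ-fromℕ< (s≤s (O₂.pos≤n (O₁.at (toℕ x))))))
                          (trans (cong toℕ e) (FP.toℕ-fromℕ< (s≤s (O₂.pos≤n (O₁.at (toℕ y))))))
          sameVertex = trans (sym (O₂.at-pos _)) (trans (cong O₂.at samePos) (O₂.at-pos _))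
      in FP.toℕ-injective (OrderingFacts.at-injective o₁ (ℕ.s≤s⁻¹ (FP.toℕ<n x)) (ℕ.s≤s⁻¹ (FP.toℕ<n y)) sameVertex)

  -- Two path orderings of the same length are connected by flips through trees
  -- with at most three leaves.  Short orderings are impossible: n ≥ 3, since
  -- s₁, a a₁, a a₂, s₂ are distinct.
  sortInto : a₁ ≢ a₂ → ∀ {n₁ n₂} → n₁ ≡ n₂ → (o₁ : Ordering n₁) (o₂ : Ordering n₂) → ∀ {P₁ P₂} →
             Realises o₁ P₁ Consecutive → Realises o₂ P₂ Consecutive → FlipSeq≤3 P₁ P₂
  sortInto _ {zero} refl o₁ _ _ _ with trans (sym (Ordering.at-0 o₁)) (Ordering.at-n o₁)
  ... | ()
  sortInto _ {1} refl o₁ _ _ _ with trans (sym (Ordering.at-1 o₁)) (Ordering.at-n o₁)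
  ... | ()
  sortInto a₁≢a₂ {2} refl o₁ _ _ _ = ⊥-elim (a₁≢a₂ (a-injective (trans (sym (Ordering.at-1 o₁)) (Ordering.at-pred-n o₁ 1 refl))))
  sortInto _ {suc (suc (suc N))} refl o₁ o₂ {P₁} {P₂} tr₁ tr₂ =
    Sorting.sortFrom o₂ P₂ tr₂ N 1 ≤-refl (+-comm N 2) o₁ P₁ tr₁ agreeOnStart
    where
    agreeOnStart : Sorting.Agree o₂ P₂ tr₂ o₁ 2
    agreeOnStart zero _ = trans (Ordering.at-0 o₁) (sym (Ordering.at-0 o₂))
    agreeOnStart (suc zero) _ = trans (Ordering.at-1 o₁) (sym (Ordering.at-1 o₂))
    agreeOnStart (suc (suc _)) (s≤s (s≤s ()))

lemma9 : (m : ℕ) (a₁ a₂ : Fin (suc m)) → a₁ ≢ a₂ → (P₁ P₂ : Sub m) →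
    𝓑.IsHamPath a₁ a₂ P₁ s₁ s₂ → 𝓑.IsHamPath a₁ a₂ P₂ s₁ s₂ →
    𝓑.FlipSeq≤3 a₁ a₂ P₁ P₂
lemma9 m a₁ a₂ a₁≢a₂ P₁ P₂ ham₁ ham₂ =
  sortInto a₁≢a₂ sameLength H₁.ordering H₂.ordering H₁.realises H₂.realises
  where
  open Orderings a₁ a₂
  module H₁ = FromHamPath ham₁
  module H₂ = FromHamPath ham₂
  sameLength = ≤-antisym (length≤ H₁.ordering H₂.ordering) (length≤ H₂.ordering H₁.ordering)
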